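{- Let $S$ be a non special numerical semigroup, $h=\max(\operatorname{SG}(S)\setminus\{\operatorname{F}(S)\})$ and $T=\mathcal{A}(S)$. Let $\operatorname{m}(S)=n_1<n_2<\cdots<n_t$ be the minimal generators of $S$. If $\operatorname{m}(S)+h\ge n_r$ for some $r\in\{1,\ldots,t\}$, then $n_2,n_3,\ldots,n_r$ are minimal generators of $T$. In particular, if $\operatorname{m}(S)+h\ge n_{t-1}$, then $\operatorname{e}(T)\ge\operatorname{e}(S)$.
   Context: $\mathbb{N}=\{0,1,2,\ldots\}$. A numerical semigroup is a submonoid $S$ of $(\mathbb{N},+)$ with $\mathbb{N}\setminus S$ finite; an element $s\in S\setminus\{0\}$ is a minimal generator if it is not a sum of two elements of $S\setminus\{0\}$, and $\operatorname{e}(S)$ is the number of minimal generators. $\operatorname{H}(S)=\mathbb{N}\setminus S$; $\operatorname{F}(S)=\max\operatorname{H}(S)$; $\operatorname{m}(S)=\min(S\setminus\{0\})$. Special gaps: $\operatorname{SG}(S)=\{h\in\operatorname{H}(S)\mid 2h\in S \text{ and } h+s\in S \text{ for all } s\in S\setminus\{0\}\}$. $S$ is special if there is no $h\in\operatorname{SG}(S)\setminus\{\operatorname{F}(S)\}$ with $h>\operatorname{m}(S)$. For non special $S$, $\mathcal{A}(S)=(S\cup\{h\})\setminus\{\operatorname{m}(S)\}$ with $h=\max(\operatorname{SG}(S)\setminus\{\operatorname{F}(S)\})$. -}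

module Defs where

open import Data.Nat using (ℕ; _+_; _*_; _≤_; _<_; _≡ᵇ_)
open import Data.Bool using (Bool; true; false; _∧_; _∨_; not)
open import Data.Product using (Σ; ∃; _×_; _,_)
open import Data.Empty using (⊥)
open import Data.List using (List; length)
open import Data.List.Membership.Propositional using (_∈_)
open import Data.List.Relation.Unary.Unique.Propositional using (Unique)
open import Relation.Nullary using (¬_)
open import Relation.Binary.PropositionalEquality using (_≡_; _≢_)
open import Function.Bundles using (_⇔_)

Subset : Set
Subset = ℕ → Bool

_∈ₛ_ : ℕ → Subset → Set
x ∈ₛ A = A x ≡ true

_∉ₛ_ : ℕ → Subset → Set
x ∉ₛ A = ¬ (x ∈ₛ A)

record NumericalSemigroup : Set where
  field
    mem      : Subset
    has-zero : 0 ∈ₛ mem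
    closed   : ∀ a b → a ∈ₛ mem → b ∈ₛ mem → (a + b) ∈ₛ mem
    cofinite : ∃ λ N → ∀ n → N ≤ n → n ∈ₛ mem
open NumericalSemigroup public

MinimalGenerator : Subset → ℕ → Set
MinimalGenerator A s =
  s ∈ₛ A × s ≢ 0 ×
  ¬ (Σ ℕ λ a → Σ ℕ λ b → a ∈ₛ A × a ≢ 0 × b ∈ₛ A × b ≢ 0 × a + b ≡ s)

IsFrobenius : NumericalSemigroup → ℕ → Set
IsFrobenius S f = f ∉ₛ mem S × (∀ n → f < n → n ∈ₛ mem S)

IsMultiplicity : NumericalSemigroup → ℕ → Set
IsMultiplicity S m =
  m ∈ₛ mem S × m ≢ 0 × (∀ x → x ∈ₛ mem S → x ≢ 0 → m ≤ x)

SpecialGap : NumericalSemigroup → ℕ → Set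
SpecialGap S h =
  h ∉ₛ mem S × (2 * h) ∈ₛ mem S ×
  (∀ s → s ∈ₛ mem S → s ≢ 0 → (h + s) ∈ₛ mem S)

NonSpecial : NumericalSemigroup → (F m : ℕ) → Set
NonSpecial S F m = Σ ℕ λ g → SpecialGap S g × g ≢ F × m < g

IsMaxSGnotF : NumericalSemigroup → (F h : ℕ) → Set
IsMaxSGnotF S F h =
  SpecialGap S h × h ≢ F × (∀ g → SpecialGap S g → g ≢ F → g ≤ h)

𝒜 : NumericalSemigroup → (m h : ℕ) → Subset
𝒜 S m h x = (mem S x ∨ (x ≡ᵇ h)) ∧ not (x ≡ᵇ m)

-- e(A) ≥ k : every duplicate-free list enumerating exactly the minimal
-- generators of A has length ≥ k (i.e. the number of minimal generators is ≥ k).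
EmbDimAtLeast : Subset → ℕ → Set
EmbDimAtLeast A k =
  (gs : List ℕ) → Unique gs → (∀ x → (x ∈ gs) ⇔ MinimalGenerator A x) → k ≤ length gs

{-# OPTIONS --safe #-}
module Submission where

-- Every nonzero element of 𝒜(S) exceeds m = m(S), and its elements below h lie in S.
-- So a minimal generator n_j ≠ m of S with n_j ≤ m + h stays minimal in 𝒜(S): in a
-- decomposition n_j = a + b the summand b exceeds m, hence a < h and a ∈ S, and
-- symmetrically b ∈ S. Also h is minimal in 𝒜(S), since its summands would lie in S,
-- and so is 2m, since a sum of two nonzero elements of 𝒜(S) is at least 2m + 2.
-- When n_{t-1} ≤ m + h this yields t distinct minimal generators 2m, h, n_2, …, n_{t-1}.

open import Defs
open import Data.Nat using (ℕ; suc; _+_; _≤_; _<_; z≤n; s≤s)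
open import Data.Nat.Properties
open import Data.Fin using (Fin; toℕ; fromℕ<) renaming (zero to fzero; suc to fsuc)
open import Data.Fin.Properties using (toℕ-injective; toℕ<n; toℕ-fromℕ<; fromℕ<-injective; injective⇒≤)
open import Data.Vec.Functional using (_∷_)
open import Data.Bool using (T; not)
open import Data.Bool.Properties using (T-≡; T-not-≡; T-∧; T-∨)
open import Data.Product using (Σ; _×_; _,_; proj₁; proj₂)
open import Data.Sum using (_⊎_; inj₁; inj₂)
import Data.Sum as Sum
open import Data.Empty using (⊥-elim)
open import Data.List using (lookup)
open import Data.List.Membership.Propositional using (_∈_)
open import Data.List.Relation.Unary.Any using (index)
open import Data.List.Relation.Unary.Any.Properties using (lookup-index)
open import Relation.Nullary.Decidable using (dec-false)
open import Relation.Binary.Definitions using (tri<; tri≈; tri>)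
open import Relation.Binary.PropositionalEquality
open import Function using (_∘_)
open import Function.Bundles using (_⇔_; Equivalence)
open Equivalence using (to; from)
open import Function.Definitions using (Injective)

private
  variable
    A B : Subset
    k x : ℕ

module _ {t : ℕ} {f : Fin t → ℕ} (f-increasing : ∀ i j → toℕ i < toℕ j → f i < f j) where

  increasing⇒monotone : ∀ {i j} → toℕ i ≤ toℕ j → f i ≤ f j
  increasing⇒monotone {i} {j} i≤j with m≤n⇒m<n∨m≡n i≤j
  ... | inj₁ i<j = <⇒≤ (f-increasing i j i<j)
  ... | inj₂ i≡j = ≤-reflexive (cong f (toℕ-injective i≡j))

  increasing⇒injective : Injective _≡_ _≡_ f
  increasing⇒injective {i} {j} fi≡fj with <-cmp (toℕ i) (toℕ j)
  ... | tri< i<j _ _ = ⊥-elim (<⇒≢ (f-increasing i j i<j) fi≡fj)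
  ... | tri≈ _ i≡j _ = toℕ-injective i≡j
  ... | tri> _ _ j<i = ⊥-elim (>⇒≢ (f-increasing j i j<i) fi≡fj)

injective-∷ : ∀ {n} {f : Fin n → ℕ} {a : ℕ}
  → Injective _≡_ _≡_ f → (∀ i → f i ≢ a) → Injective _≡_ _≡_ (a ∷ f)
injective-∷ f-inj a∉f {fzero}  {fzero}  _     = refl
injective-∷ f-inj a∉f {fzero}  {fsuc j} a≡fj  = ⊥-elim (a∉f j (sym a≡fj))
injective-∷ f-inj a∉f {fsuc i} {fzero}  fi≡a  = ⊥-elim (a∉f i fi≡a)
injective-∷ f-inj a∉f {fsuc i} {fsuc j} fi≡fj = cong fsuc (f-inj fi≡fj)

minimalGenerator-transfer : MinimalGenerator B x → x ∈ₛ A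
  → (∀ {a b} → a ∈ₛ A → a ≢ 0 → b ∈ₛ A → b ≢ 0 → a + b ≡ x → a ∈ₛ B)
  → MinimalGenerator A x
minimalGenerator-transfer (_ , x≢0 , x-indecomposable) x∈A summand∈B =
  x∈A , x≢0 , λ (a , b , a∈A , a≢0 , b∈A , b≢0 , a+b≡x) →
    x-indecomposable
      ( a , b
      , summand∈B a∈A a≢0 b∈A b≢0 a+b≡x , a≢0
      , summand∈B b∈A b≢0 a∈A a≢0 (trans (+-comm b a) a+b≡x) , b≢0
      , a+b≡x)

minimalGenerator-outsideClosed : (∀ a b → a ∈ₛ B → b ∈ₛ B → (a + b) ∈ₛ B) → x ∉ₛ B
  → x ∈ₛ A → x ≢ 0 → (∀ {y} → y ∈ₛ A → y < x → y ∈ₛ B)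
  → MinimalGenerator A x
minimalGenerator-outsideClosed {B} B-closed x∉B x∈A x≢0 below∈B =
  x∈A , x≢0 , λ (a , b , a∈A , a≢0 , b∈A , b≢0 , a+b≡x) →
    x∉B (subst (_∈ₛ B) a+b≡x
      (B-closed a b
        (below∈B a∈A (subst (a <_) a+b≡x (m<m+n a (n≢0⇒n>0 b≢0))))
        (below∈B b∈A (subst (b <_) (trans (+-comm b a) a+b≡x) (m<m+n b (n≢0⇒n>0 a≢0))))))

minimalGenerator-belowDouble : (∀ {y} → y ∈ₛ A → y ≢ 0 → k < y)
  → x ∈ₛ A → x ≢ 0 → x < suc k + suc k → MinimalGenerator A x
minimalGenerator-belowDouble {k = k} above-k x∈A x≢0 x<2k+2 =
  x∈A , x≢0 , λ (a , b , a∈A , a≢0 , b∈A , b≢0 , a+b≡x) →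
    <⇒≱ x<2k+2 (subst (suc k + suc k ≤_) a+b≡x (+-mono-≤ (above-k a∈A a≢0) (above-k b∈A b≢0)))

minimalGenerator≢double : ∀ {a} → MinimalGenerator A x → a ∈ₛ A → a ≢ 0 → x ≢ a + a
minimalGenerator≢double {a = a} (_ , _ , x-indecomposable) a∈A a≢0 x≡a+a =
  x-indecomposable (a , a , a∈A , a≢0 , a∈A , a≢0 , sym x≡a+a)

injectiveMinimalGenerators⇒EmbDimAtLeast : (g : Fin k → ℕ) → Injective _≡_ _≡_ g
  → (∀ i → MinimalGenerator A (g i)) → EmbDimAtLeast A k
injectiveMinimalGenerators⇒EmbDimAtLeast g g-inj g-minimal gs _ gs-enumerates =
  injective⇒≤ (λ {i} {j} pos-i≡pos-j → g-inj (begin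
    g i                 ≡⟨ lookup-index (g∈gs i) ⟩
    lookup gs (pos i)   ≡⟨ cong (lookup gs) pos-i≡pos-j ⟩
    lookup gs (pos j)   ≡⟨ lookup-index (g∈gs j) ⟨
    g j                 ∎))
  where
  open ≡-Reasoning
  g∈gs : ∀ i → g i ∈ gs
  g∈gs i = from (gs-enumerates (g i)) (g-minimal i)
  pos : Fin _ → Fin _
  pos i = index (g∈gs i)

module _ (S : NumericalSemigroup) {m h : ℕ} where

  ∈𝒜⁺ : x ∈ₛ mem S ⊎ x ≡ h → x ≢ m → x ∈ₛ 𝒜 S m h
  ∈𝒜⁺ {x} x∈S⊎x≡h x≢m = to T-≡ (from T-∧
    ( from T-∨ (Sum.map (from T-≡) (≡⇒≡ᵇ x h) x∈S⊎x≡h)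
    , from T-not-≡ (dec-false (x ≟ m) x≢m)))

  ∈𝒜⁻ : x ∈ₛ 𝒜 S m h → (x ∈ₛ mem S ⊎ x ≡ h) × x ≢ m
  ∈𝒜⁻ {x} x∈𝒜 with to T-∧ (from T-≡ x∈𝒜)
  ... | x∈S∪h , x≉m =
    Sum.map (to T-≡) (≡ᵇ⇒≡ x h) (to T-∨ x∈S∪h) ,
    λ x≡m → subst (T ∘ not) (to T-≡ (≡⇒≡ᵇ x m x≡m)) x≉m

  ∈𝒜-<⇒∈S : x ∈ₛ 𝒜 S m h → x < h → x ∈ₛ mem S
  ∈𝒜-<⇒∈S x∈𝒜 x<h with ∈𝒜⁻ x∈𝒜
  ... | inj₁ x∈S , _ = x∈S
  ... | inj₂ refl , _ = ⊥-elim (<-irrefl refl x<h)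

module _ (S : NumericalSemigroup) {m h : ℕ}
         (m-multiplicity : IsMultiplicity S m) (m<h : m < h) where

  private
    m∈S : m ∈ₛ mem S
    m∈S = proj₁ m-multiplicity

    m≢0 : m ≢ 0
    m≢0 = proj₁ (proj₂ m-multiplicity)

    multiplicity-least : x ∈ₛ mem S → x ≢ 0 → m ≤ x
    multiplicity-least = proj₂ (proj₂ m-multiplicity) _

  nonzero∈𝒜⇒multiplicity< : x ∈ₛ 𝒜 S m h → x ≢ 0 → m < x
  nonzero∈𝒜⇒multiplicity< x∈𝒜 x≢0 with ∈𝒜⁻ S x∈𝒜
  ... | inj₁ x∈S , x≢m = ≤∧≢⇒< (multiplicity-least x∈S x≢0) (≢-sym x≢m)
  ... | inj₂ refl , _  = m<h

  double-multiplicity-minimal : MinimalGenerator (𝒜 S m h) (m + m)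
  double-multiplicity-minimal =
    minimalGenerator-belowDouble nonzero∈𝒜⇒multiplicity<
      (∈𝒜⁺ S (inj₁ (closed S m m m∈S m∈S)) (>⇒≢ m<m+m))
      (n>0⇒n≢0 (≤-<-trans z≤n m<m+m))
      (+-mono-< (n<1+n m) (n<1+n m))
    where
    m<m+m : m < m + m
    m<m+m = m<m+n m (n≢0⇒n>0 m≢0)

  gap-minimal : h ∉ₛ mem S → MinimalGenerator (𝒜 S m h) h
  gap-minimal h∉S =
    minimalGenerator-outsideClosed (closed S) h∉S
      (∈𝒜⁺ S (inj₂ refl) (>⇒≢ m<h)) (n>0⇒n≢0 (≤-<-trans z≤n m<h)) (∈𝒜-<⇒∈S S)

  generator-minimal : MinimalGenerator (mem S) x → x ≢ m → x ≤ m + h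
    → MinimalGenerator (𝒜 S m h) x
  generator-minimal {x} x-minimal@(x∈S , _) x≢m x≤m+h =
    minimalGenerator-transfer x-minimal (∈𝒜⁺ S (inj₁ x∈S) x≢m) summand∈S
    where
    summand∈S : ∀ {a b} → a ∈ₛ 𝒜 S m h → a ≢ 0 → b ∈ₛ 𝒜 S m h → b ≢ 0 → a + b ≡ x
      → a ∈ₛ mem S
    summand∈S {a} {b} a∈𝒜 _ b∈𝒜 b≢0 a+b≡x =
      ∈𝒜-<⇒∈S S a∈𝒜 (+-cancelʳ-< m a h (begin-strict
        a + m  <⟨ +-monoʳ-< a (nonzero∈𝒜⇒multiplicity< b∈𝒜 b≢0) ⟩
        a + b  ≡⟨ a+b≡x ⟩
        x      ≤⟨ x≤m+h ⟩
        m + h  ≡⟨ +-comm m h ⟩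
        h + m  ∎))
      where open ≤-Reasoning

  module _ {t : ℕ} (n : Fin t → ℕ) (n-increasing : ∀ i j → toℕ i < toℕ j → n i < n j)
           (n-minimal : ∀ i → MinimalGenerator (mem S) (n i)) where

    multiplicity<laterGenerator : ∀ j → 1 ≤ toℕ j → m < n j
    multiplicity<laterGenerator (fsuc j) _ =
      let (n₀∈S , n₀≢0 , _) = n-minimal fzero
      in ≤-<-trans (multiplicity-least n₀∈S n₀≢0) (n-increasing fzero (fsuc j) (s≤s z≤n))

    laterGenerators-minimal : (r : Fin t) → n r ≤ m + h
      → (j : Fin t) → 1 ≤ toℕ j → toℕ j ≤ toℕ r → MinimalGenerator (𝒜 S m h) (n j)
    laterGenerators-minimal r nr≤m+h j 1≤j j≤r =
      generator-minimal (n-minimal j)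
        (>⇒≢ (multiplicity<laterGenerator j 1≤j))
        (≤-trans (increasing⇒monotone n-increasing j≤r) nr≤m+h)

    embDim-preserved : h ∉ₛ mem S
      → (r : Fin t) → toℕ r + 2 ≡ t → n r ≤ m + h → EmbDimAtLeast (𝒜 S m h) t
    embDim-preserved h∉S r r+2≡t nr≤m+h =
      subst (EmbDimAtLeast (𝒜 S m h)) 2+r≡t
        (injectiveMinimalGenerators⇒EmbDimAtLeast generators generators-injective generators-minimal)
      where
      2+r≡t : 2 + toℕ r ≡ t
      2+r≡t = trans (+-comm 2 (toℕ r)) r+2≡t

      middle : Fin (toℕ r) → Fin t
      middle i = fromℕ< (subst (suc (toℕ i) <_) 2+r≡t (s≤s (m<n⇒m<1+n (toℕ<n i))))

      generators : Fin (2 + toℕ r) → ℕ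
      generators = (m + m) ∷ h ∷ (n ∘ middle)

      generators-injective : Injective _≡_ _≡_ generators
      generators-injective =
        injective-∷ (injective-∷ later-injective later≢h)
                    λ { fzero → h≢m+m ; (fsuc i) → later≢m+m i }
        where
        middle-injective : Injective _≡_ _≡_ middle
        middle-injective e = toℕ-injective (suc-injective (fromℕ<-injective _ _ _ _ e))
        later-injective : Injective _≡_ _≡_ (n ∘ middle)
        later-injective e = middle-injective (increasing⇒injective n-increasing e)
        later≢h : ∀ i → n (middle i) ≢ h
        later≢h i ni≡h = h∉S (subst (_∈ₛ mem S) ni≡h (proj₁ (n-minimal (middle i))))
        h≢m+m : h ≢ m + m
        h≢m+m h≡m+m = h∉S (subst (_∈ₛ mem S) (sym h≡m+m) (closed S m m m∈S m∈S))
        later≢m+m : ∀ i → n (middle i) ≢ m + m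
        later≢m+m i = minimalGenerator≢double (n-minimal (middle i)) m∈S m≢0

      generators-minimal : ∀ i → MinimalGenerator (𝒜 S m h) (generators i)
      generators-minimal fzero            = double-multiplicity-minimal
      generators-minimal (fsuc fzero)     = gap-minimal h∉S
      generators-minimal (fsuc (fsuc i))  =
        laterGenerators-minimal r nr≤m+h (middle i)
          (subst (1 ≤_) (sym (toℕ-fromℕ< _)) (s≤s z≤n))
          (subst (_≤ toℕ r) (sym (toℕ-fromℕ< _)) (toℕ<n i))

lemma4p8 : (S : NumericalSemigroup) (F m h : ℕ)
    → IsFrobenius S F → IsMultiplicity S m
    → NonSpecial S F m → IsMaxSGnotF S F h
    → (t : ℕ) (n : Fin t → ℕ)
    → (∀ i j → toℕ i < toℕ j → n i < n j)
    → (∀ x → MinimalGenerator (mem S) x ⇔ Σ (Fin t) (λ i → n i ≡ x))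
    → ((r : Fin t) → n r ≤ m + h
        → (j : Fin t) → 1 ≤ toℕ j → toℕ j ≤ toℕ r
        → MinimalGenerator (𝒜 S m h) (n j))
      × ((r : Fin t) → toℕ r + 2 ≡ t → n r ≤ m + h
        → EmbDimAtLeast (𝒜 S m h) t)
lemma4p8 S F m h _ m-multiplicity (g , g-special , g≢F , m<g) ((h∉S , _) , _ , h-maximal)
         t n n-increasing n-generates =
  laterGenerators-minimal S m-multiplicity m<h n n-increasing n-minimal ,
  embDim-preserved S m-multiplicity m<h n n-increasing n-minimal h∉S
  where
  m<h : m < h
  m<h = <-≤-trans m<g (h-maximal g g-special g≢F)
  n-minimal : ∀ i → MinimalGenerator (mem S) (n i)
  n-minimal i = from (n-generates (n i)) (i , refl)
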